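{- Let $n,m$ be non-negative integers with $m\ge 2$. The number of sequences of balls (of any finite length) colored in at most $n$ colors that contain exactly $m$ balls having the same color as some other ball is $$\sum_{k=m}^{m+n-1}\ \sum_{\lambda=0}^{\min\{\lfloor m/2\rfloor,\, n-k+m\}} Z(k,n,m,\lambda).$$
   Context: A sequence of $k$ balls colored in at most $n$ colors is a function $c:\{1,\dots,k\}\to\{1,\dots,n\}$; sequences of different lengths are different. A ball $i$ matches another ball if there is $j\ne i$ with $c(j)=c(i)$; a color is repeated if it is the color of at least two balls. $Z(k,n,m,\lambda)$ denotes the number of such sequences of length $k$ in which exactly $m$ balls match some other ball and exactly $\lambda$ colors are repeated. -}

module Defs where

open import Data.Nat using (ℕ; zero; suc; _+_; _∸_; _⊓_; _/_; _≟_)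
open import Data.Fin using (Fin; _≟_)
open import Data.Fin.Properties using (any?)
open import Data.Vec using (Vec; []; _∷_; lookup)
open import Data.List using (List; []; _∷_; length; filter; map; concatMap; allFin; upTo)
open import Data.Nat.ListAction using (sum)
open import Data.Product using (Σ; ∃-syntax; _×_; _,_)
open import Relation.Nullary using (Dec; ¬_)
open import Relation.Nullary.Decidable using (_×-dec_; ¬?)
open import Relation.Binary.PropositionalEquality using (_≡_; _≢_)

-- A sequence of k balls coloured in at most n colours: a vector of length k
-- with entries in Fin n (ball i has colour  lookup c i).
Seq : ℕ → ℕ → Set
Seq k n = Vec (Fin n) k

Matches : ∀ {k n} → Seq k n → Fin k → Set
Matches c i = ∃[ j ] (j ≢ i × lookup c j ≡ lookup c i)

matches? : ∀ {k n} (c : Seq k n) (i : Fin k) → Dec (Matches c i)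
matches? c i = any? (λ j → ¬? (j Data.Fin.≟ i) ×-dec (lookup c j Data.Fin.≟ lookup c i))

Repeated : ∀ {k n} → Seq k n → Fin n → Set
Repeated c x = ∃[ i ] ∃[ j ] (i ≢ j × lookup c i ≡ x × lookup c j ≡ x)

repeated? : ∀ {k n} (c : Seq k n) (x : Fin n) → Dec (Repeated c x)
repeated? c x = any? (λ i → any? (λ j →
  ¬? (i Data.Fin.≟ j) ×-dec (lookup c i Data.Fin.≟ x) ×-dec (lookup c j Data.Fin.≟ x)))

numMatching : ∀ {k n} → Seq k n → ℕ
numMatching {k} c = length (filter (matches? c) (allFin k))

numRepeated : ∀ {k n} → Seq k n → ℕ
numRepeated {n = n} c = length (filter (repeated? c) (allFin n))

allSeqs : (k n : ℕ) → List (Seq k n)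
allSeqs zero    n = [] ∷ []
allSeqs (suc k) n = concatMap (λ c → map (λ x → x ∷ c) (allFin n)) (allSeqs k n)

Z : ℕ → ℕ → ℕ → ℕ → ℕ
Z k n m l = length (filter (λ c → (numMatching c Data.Nat.≟ m) ×-dec (numRepeated c Data.Nat.≟ l)) (allSeqs k n))

-- Σ_{i=a}^{b} f i  (empty if b < a)
sumFromTo : ℕ → ℕ → (ℕ → ℕ) → ℕ
sumFromTo a b f = sum (map (λ i → f (a + i)) (upTo (suc b ∸ a)))

module Submission where

-- The theorem is proved by an explicit bijection between the sequences (of
-- any length k) with exactly m matching balls and the positions of the
-- iterated sum.
--
-- A list enumerates a type when proofs of Any P over the list
-- correspond to witnesses of P; then "number of list elements satisfying P?"
-- is, as a Fin, isomorphic to the subtype cut out by P?.  allFin and allSeqs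
-- are enumerations, and a sum over a range is, as a Fin, a dependent pair of
-- an index and a position in the summand.
--
-- For one sequence c of length k, let u be the number of lonely
-- (non-matching) balls and r the number of repeated colours.  Then
-- k = m + u; colours of lonely balls are pairwise distinct and distinct from
-- repeated colours, so r + u ≤ n; each repeated colour owns two distinct
-- matching balls, so 2r ≤ m; and m ≥ 1 forces r ≥ 1.  Hence m ≤ k ≤ m + n - 1
-- and r ≤ min(m/2, n + m - k).
--
-- Assembly.  For fixed k, sorting sequences by r gives the inner sum (every
-- r lies in the summation range); reindexing k by the window m ≤ k ≤ m+n-1
-- gives the outer sum.

open import Defs
open import Data.Nat using (ℕ; zero; suc; _+_; _*_; _∸_; _⊓_; _/_; _≤_; _<_; z≤n; s≤s) renaming (_≟_ to _≟ℕ_)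
open import Data.Nat.Properties
  using ( module ≤-Reasoning; ≡-irrelevant; +-comm; +-identityʳ; *-comm; +-suc; +-monoˡ-≤; ≤-trans; ⊓-glb
        ; m≤m+n; m+n∸m≡n; m+[n∸m]≡n; m+n≤o⇒m≤o∸n; [m+n]∸[m+o]≡n∸o)
open import Data.Nat.DivMod using (m*n/n≡m; /-monoˡ-≤)
open import Data.Nat.ListAction using (sum)
open import Data.Fin using (Fin; zero; suc; toℕ; fromℕ<; _≟_)
open import Data.Fin.Properties using (0↔⊥; 1↔⊤; +↔⊎; injective⇒≤; toℕ-fromℕ<; toℕ-injective)
open import Data.Vec using (Vec; []; _∷_; lookup)
open import Data.List using (List; []; _∷_; length; filter; map; tabulate; applyUpTo; allFin; upTo)
open import Data.List.Properties using (length-tabulate)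
open import Data.List.Relation.Unary.Any using (Any; here)
open import Data.List.Relation.Unary.Any.Properties using (⊥↔Any[]; ∷↔; map↔; concat↔; Any-cong)
open import Data.Product using (Σ; _×_; _,_; proj₁; proj₂)
open import Data.Product.Function.Dependent.Propositional using () renaming (congˡ to Σ-congˡ)
open import Data.Sum using (_⊎_; inj₁; inj₂; [_,_])
open import Data.Sum.Function.Propositional using (_⊎-cong_)
open import Data.Empty using (⊥; ⊥-elim)
open import Data.Bool.Properties using (T-irrelevant)
open import Function using (_∘_; id)
open import Function.Bundles using (_↔_; _↣_; mk↔ₛ′; mk↣; Injection; Inverse)
open import Function.Properties.Inverse using (↔-refl; ↔-sym; ↔-trans; ↔⇒↣)
open import Function.Properties.Injection using (↣-trans)
import Function.Related.Propositional as Related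
open import Function.Related.TypeIsomorphisms using (∃∃↔∃∃)
open import Relation.Nullary using (yes; no; Irrelevant)
open import Relation.Nullary.Decidable using (True; toWitness; fromWitness; ¬?; _×-dec_)
open import Relation.Unary using (Decidable)
open import Relation.Binary.PropositionalEquality using (_≡_; _≢_; refl; sym; trans; cong; subst; module ≡-Reasoning)


Σ-Fin-suc : ∀ {n} (R : Fin (suc n) → Set) → Σ (Fin (suc n)) R ↔ (R zero ⊎ Σ (Fin n) (R ∘ suc))
Σ-Fin-suc {n} R = mk↔ₛ′ split join (λ { (inj₁ _) → refl ; (inj₂ _) → refl })
                                    (λ { (zero , _) → refl ; (suc _ , _) → refl })
  where
  split : Σ (Fin (suc n)) R → R zero ⊎ Σ (Fin n) (R ∘ suc)
  split (zero , r)  = inj₁ r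
  split (suc i , r) = inj₂ (i , r)
  join : R zero ⊎ Σ (Fin n) (R ∘ suc) → Σ (Fin (suc n)) R
  join (inj₁ r)       = zero , r
  join (inj₂ (i , r)) = suc i , r

Σ-Fin-zero : (R : Fin 0 → Set) → Σ (Fin 0) R ↔ ⊥
Σ-Fin-zero R = mk↔ₛ′ (λ { (() , _) }) (λ ()) (λ ()) (λ { (() , _) })

Σ-Vec-∷ : ∀ {A : Set} {k} (P : Vec A (suc k) → Set) →
          Σ (Vec A k) (λ c → Σ A (λ x → P (x ∷ c))) ↔ Σ (Vec A (suc k)) P
Σ-Vec-∷ {A} {k} P = mk↔ₛ′ (λ { (c , x , p) → x ∷ c , p }) (λ { (x ∷ c , p) → c , x , p })
                          (λ { (x ∷ c , p) → refl }) (λ { (c , x , p) → refl })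

irrelevant-↔ : {A B : Set} → Irrelevant A → Irrelevant B → (A → B) → (B → A) → A ↔ B
irrelevant-↔ irrA irrB f g = mk↔ₛ′ f g (λ _ → irrB _ _) (λ _ → irrA _ _)

subtype-≡ : {A : Set} {P : A → Set} {P? : Decidable P} {x y : A} {p : True (P? x)} {q : True (P? y)} →
            x ≡ y → _≡_ {A = Σ A (λ a → True (P? a))} (x , p) (y , q)
subtype-≡ refl = cong (_ ,_) (T-irrelevant _ _)

-- Transporting along an equation of natural numbers whose two sides index
-- equal points leaves a dependent pair unchanged (ℕ has unique identity proofs).
Σ-transport : {I : Set} {S : ℕ → Set} (f : I → ℕ) {i j : I} → i ≡ j → (e : f i ≡ f j) (s : S (f i)) →
              _≡_ {A = Σ I (S ∘ f)} (j , subst S e s) (i , s)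
Σ-transport f refl e s rewrite ≡-irrelevant e refl = refl

Σ-window : (S : ℕ → Set) (m L : ℕ) → (∀ k → S k → m ≤ k × k ∸ m < L) →
           Σ ℕ S ↔ Σ (Fin L) (λ i → S (m + toℕ i))
Σ-window S m L window = mk↔ₛ′ to from to∘from from∘to
  where
  index : ∀ {k} → S k → Fin L
  index {k} s = fromℕ< (proj₂ (window k s))
  index-correct : ∀ {k} (s : S k) → k ≡ m + toℕ (index s)
  index-correct {k} s = trans (sym (m+[n∸m]≡n (proj₁ (window k s)))) (cong (m +_) (sym (toℕ-fromℕ< _)))
  to : Σ ℕ S → Σ (Fin L) (λ i → S (m + toℕ i))
  to (k , s) = index s , subst S (index-correct s) s
  from : Σ (Fin L) (λ i → S (m + toℕ i)) → Σ ℕ S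
  from (i , s) = m + toℕ i , s
  to∘from : ∀ y → to (from y) ≡ y
  to∘from (i , s) = Σ-transport (λ j → m + toℕ j) (sym (toℕ-injective index-of-shift)) (index-correct s) s
    where
    index-of-shift : toℕ (index s) ≡ toℕ i
    index-of-shift = trans (toℕ-fromℕ< _) (m+n∸m≡n m (toℕ i))
  from∘to : ∀ x → from (to x) ≡ x
  from∘to (k , s) = Σ-transport id (index-correct s) (index-correct s) s

Fin-filter : {A : Set} {P : A → Set} (P? : Decidable P) (xs : List A) →
             Fin (length (filter P? xs)) ↔ Any (λ x → True (P? x)) xs
Fin-filter P? []       = ↔-trans 0↔⊥ ⊥↔Any[]
Fin-filter P? (x ∷ xs) = ↔-trans head (↔-trans (↔-refl ⊎-cong Fin-filter P? xs) (∷↔ _))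
  where
  head : Fin (length (filter P? (x ∷ xs))) ↔ (True (P? x) ⊎ Fin (length (filter P? xs)))
  head with P? x
  ... | yes _ = ↔-trans (+↔⊎ {1}) (1↔⊤ ⊎-cong ↔-refl)
  ... | no  _ = ↔-trans (+↔⊎ {0}) (0↔⊥ ⊎-cong ↔-refl)

filter-split : {A : Set} {P : A → Set} (P? : Decidable P) (xs : List A) →
               length (filter P? xs) + length (filter (λ x → ¬? (P? x)) xs) ≡ length xs
filter-split P? []       = refl
filter-split P? (x ∷ xs) with P? x
... | yes _ = cong suc (filter-split P? xs)
... | no  _ = trans (+-suc _ _) (cong suc (filter-split P? xs))

Enumerates : {A : Set} → List A → Set₁
Enumerates {A} xs = {P : A → Set} → Any P xs ↔ Σ A P

count : {A : Set} {xs : List A} → Enumerates xs → {P : A → Set} (P? : Decidable P) →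
        Fin (length (filter P? xs)) ↔ Σ A (λ x → True (P? x))
count {xs = xs} enum P? = ↔-trans (Fin-filter P? xs) enum

Any-tabulate : ∀ {A : Set} {n} {P : A → Set} (g : Fin n → A) → Any P (tabulate g) ↔ Σ (Fin n) (P ∘ g)
Any-tabulate {n = zero}      g = ↔-trans (↔-sym ⊥↔Any[]) (↔-sym (Σ-Fin-zero _))
Any-tabulate {n = suc n} {P} g =
  ↔-trans (↔-sym (∷↔ P)) (↔-trans (↔-refl ⊎-cong Any-tabulate (g ∘ suc)) (↔-sym (Σ-Fin-suc (P ∘ g))))

Any-applyUpTo : ∀ {A : Set} {P : A → Set} (f : ℕ → A) L → Any P (applyUpTo f L) ↔ Σ (Fin L) (P ∘ f ∘ toℕ)
Any-applyUpTo         f zero    = ↔-trans (↔-sym ⊥↔Any[]) (↔-sym (Σ-Fin-zero _))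
Any-applyUpTo {P = P} f (suc L) =
  ↔-trans (↔-sym (∷↔ P)) (↔-trans (↔-refl ⊎-cong Any-applyUpTo (f ∘ suc) L) (↔-sym (Σ-Fin-suc (P ∘ f ∘ toℕ))))

allFin-enumerates : ∀ n → Enumerates (allFin n)
allFin-enumerates n = Any-tabulate id

allSeqs-enumerates : ∀ k n → Enumerates (allSeqs k n)
allSeqs-enumerates zero    n = mk↔ₛ′ (λ { (here p) → [] , p }) (λ { ([] , p) → here p })
                                     (λ { ([] , p) → refl }) (λ { (here p) → refl })
allSeqs-enumerates (suc k) n {P} =
  Any P (allSeqs (suc k) n)
    ↔⟨ concat↔ ⟨
  Any (Any P) (map heads (allSeqs k n))
    ↔⟨ map↔ ⟨
  Any (Any P ∘ heads) (allSeqs k n)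
    ↔⟨ Any-cong (λ c → ↔-trans (↔-sym map↔) (allFin-enumerates n)) ↔-refl ⟩
  Any (λ c → Σ (Fin n) (λ x → P (x ∷ c))) (allSeqs k n)
    ↔⟨ allSeqs-enumerates k n ⟩
  Σ (Seq k n) (λ c → Σ (Fin n) (λ x → P (x ∷ c)))
    ↔⟨ Σ-Vec-∷ P ⟩
  Σ (Seq (suc k) n) P ∎
  where
  open Related.EquationalReasoning
  heads : Seq k n → List (Seq (suc k) n)
  heads c = map (_∷ c) (allFin n)

Fin-sum : {A : Set} (f : A → ℕ) (xs : List A) → Fin (sum (map f xs)) ↔ Any (λ x → Fin (f x)) xs
Fin-sum f []       = ↔-trans 0↔⊥ ⊥↔Any[]
Fin-sum f (x ∷ xs) = ↔-trans +↔⊎ (↔-trans (↔-refl ⊎-cong Fin-sum f xs) (∷↔ _))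

Fin-sumFromTo : ∀ a b (f : ℕ → ℕ) → Fin (sumFromTo a b f) ↔ Σ (Fin (suc b ∸ a)) (λ i → Fin (f (a + toℕ i)))
Fin-sumFromTo a b f = ↔-trans (Fin-sum _ (upTo (suc b ∸ a))) (Any-applyUpTo id (suc b ∸ a))

≤-by-injection : {X Y : Set} {a b : ℕ} → Fin a ↔ X → Fin b ↔ Y → X ↣ Y → a ≤ b
≤-by-injection countX countY h =
  injective⇒≤ (Injection.injective (↣-trans (↔⇒↣ countX) (↣-trans h (↔⇒↣ (↔-sym countY)))))

module SequenceFacts {k n : ℕ} (c : Seq k n) where

  RepeatedColour : Set
  RepeatedColour = Σ (Fin n) (λ x → True (repeated? c x))

  MatchingBall : Set
  MatchingBall = Σ (Fin k) (λ i → True (matches? c i))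

  LonelyBall : Set
  LonelyBall = Σ (Fin k) (λ i → True (¬? (matches? c i)))

  numLonely : ℕ
  numLonely = length (filter (λ i → ¬? (matches? c i)) (allFin k))

  matching+lonely : numMatching c + numLonely ≡ k
  matching+lonely = trans (filter-split (matches? c) (allFin k)) (length-tabulate id)

  lonelyColourUnique : (b : LonelyBall) → ∀ j → j ≢ proj₁ b → lookup c j ≢ lookup c (proj₁ b)
  lonelyColourUnique (i , lonely) j j≢i cj≡ci = toWitness lonely (j , j≢i , cj≡ci)

  lonelyNotRepeated : (s : RepeatedColour) (b : LonelyBall) → proj₁ s ≢ lookup c (proj₁ b)
  lonelyNotRepeated (x , rep) b x≡cb with toWitness rep
  ... | i , j , i≢j , ci≡x , cj≡x with i ≟ proj₁ b
  ...   | no  i≢b = lonelyColourUnique b i i≢b (trans ci≡x x≡cb)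
  ...   | yes i≡b = lonelyColourUnique b j (λ j≡b → i≢j (trans i≡b (sym j≡b))) (trans cj≡x x≡cb)

  colour : RepeatedColour ⊎ LonelyBall → Fin n
  colour = [ proj₁ , lookup c ∘ proj₁ ]

  colour-injective : ∀ {u v} → colour u ≡ colour v → u ≡ v
  colour-injective {inj₁ s} {inj₁ s'} e = cong inj₁ (subtype-≡ e)
  colour-injective {inj₁ s} {inj₂ b}  e = ⊥-elim (lonelyNotRepeated s b e)
  colour-injective {inj₂ b} {inj₁ s}  e = ⊥-elim (lonelyNotRepeated s b (sym e))
  colour-injective {inj₂ b} {inj₂ b'} e with proj₁ b ≟ proj₁ b'
  ... | yes b≡b' = cong inj₂ (subtype-≡ b≡b')
  ... | no  b≢b' = ⊥-elim (lonelyColourUnique b' (proj₁ b) b≢b' e)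

  repeated+lonely≤n : numRepeated c + numLonely ≤ n
  repeated+lonely≤n =
    ≤-by-injection (↔-trans +↔⊎ (count (allFin-enumerates n) (repeated? c) ⊎-cong
                                 count (allFin-enumerates k) (λ i → ¬? (matches? c i))))
                   ↔-refl (mk↣ colour-injective)

  -- Each repeated colour owns two distinct matching balls: the first and
  -- the second ball of its witness.

  swapWitness : ∀ {x} → Repeated c x → Repeated c x
  swapWitness (i , j , i≢j , ci , cj) = j , i , (λ j≡i → i≢j (sym j≡i)) , cj , ci

  witness : RepeatedColour ⊎ RepeatedColour → Σ (Fin n) (Repeated c)
  witness (inj₁ (x , rep)) = x , toWitness rep
  witness (inj₂ (x , rep)) = x , swapWitness (toWitness rep)

  firstBall : Σ (Fin n) (Repeated c) → MatchingBall
  firstBall (x , i , j , i≢j , ci , cj) = i , fromWitness (j , (λ j≡i → i≢j (sym j≡i)) , trans cj (sym ci))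

  pickBall : RepeatedColour ⊎ RepeatedColour → MatchingBall
  pickBall = firstBall ∘ witness

  colourOf : RepeatedColour ⊎ RepeatedColour → RepeatedColour
  colourOf = [ id , id ]

  firstBall-colour : ∀ w → lookup c (proj₁ (firstBall w)) ≡ proj₁ w
  firstBall-colour (x , i , j , i≢j , ci , cj) = ci

  pickBall-colour : ∀ z → lookup c (proj₁ (pickBall z)) ≡ proj₁ (colourOf z)
  pickBall-colour (inj₁ s) = firstBall-colour (witness (inj₁ s))
  pickBall-colour (inj₂ s) = firstBall-colour (witness (inj₂ s))

  distinctBalls : ∀ s → proj₁ (pickBall (inj₁ s)) ≢ proj₁ (pickBall (inj₂ s))
  distinctBalls (x , rep) = let (i , j , i≢j , _) = toWitness rep in i≢j

  pickBall-injective : ∀ {u v} → pickBall u ≡ pickBall v → u ≡ v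
  pickBall-injective {u} {v} e = sameColour u v (cong proj₁ e) (subtype-≡ colours)
    where
    colours : proj₁ (colourOf u) ≡ proj₁ (colourOf v)
    colours = trans (sym (pickBall-colour u)) (trans (cong (lookup c ∘ proj₁) e) (pickBall-colour v))
    sameColour : ∀ u v → proj₁ (pickBall u) ≡ proj₁ (pickBall v) → colourOf u ≡ colourOf v → u ≡ v
    sameColour (inj₁ s) (inj₁ .s) _ refl = refl
    sameColour (inj₂ s) (inj₂ .s) _ refl = refl
    sameColour (inj₁ s) (inj₂ .s) e refl = ⊥-elim (distinctBalls s e)
    sameColour (inj₂ s) (inj₁ .s) e refl = ⊥-elim (distinctBalls s (sym e))

  twiceRepeated≤matching : numRepeated c + numRepeated c ≤ numMatching c
  twiceRepeated≤matching =
    ≤-by-injection (↔-trans +↔⊎ (countRepeated ⊎-cong countRepeated))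
                   (count (allFin-enumerates k) (matches? c)) (mk↣ pickBall-injective)
    where
    countRepeated : Fin (numRepeated c) ↔ RepeatedColour
    countRepeated = count (allFin-enumerates n) (repeated? c)

  matchingColour : MatchingBall → RepeatedColour
  matchingColour (i , match) =
    let (j , j≢i , cj≡ci) = toWitness match
    in lookup c i , fromWitness (i , j , (λ i≡j → j≢i (sym i≡j)) , refl , cj≡ci)

  someRepeated : 1 ≤ numMatching c → 1 ≤ numRepeated c
  someRepeated 1≤m =
    positive (Inverse.from countRepeated (matchingColour (Inverse.to countMatching (fromℕ< 1≤m))))
    where
    countRepeated : Fin (numRepeated c) ↔ RepeatedColour
    countRepeated = count (allFin-enumerates n) (repeated? c)
    countMatching : Fin (numMatching c) ↔ MatchingBall
    countMatching = count (allFin-enumerates k) (matches? c)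
    positive : ∀ {a} → Fin a → 1 ≤ a
    positive zero    = s≤s z≤n
    positive (suc _) = s≤s z≤n

  k∸matching≡lonely : k ∸ numMatching c ≡ numLonely
  k∸matching≡lonely = trans (cong (_∸ numMatching c) (sym matching+lonely)) (m+n∸m≡n (numMatching c) numLonely)

  matching≤length : numMatching c ≤ k
  matching≤length = subst (numMatching c ≤_) matching+lonely (m≤m+n (numMatching c) numLonely)

  length∸matching<n : 1 ≤ numMatching c → k ∸ numMatching c < n
  length∸matching<n 1≤m = subst (_< n) (sym k∸matching≡lonely)
    (≤-trans (+-monoˡ-≤ numLonely (someRepeated 1≤m)) repeated+lonely≤n)

  repeated≤half : numRepeated c ≤ numMatching c / 2
  repeated≤half = begin
    numRepeated c             ≡⟨ sym (m*n/n≡m (numRepeated c) 2) ⟩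
    numRepeated c * 2 / 2     ≤⟨ /-monoˡ-≤ 2 (subst (_≤ numMatching c) r+r≡r*2 twiceRepeated≤matching) ⟩
    numMatching c / 2         ∎
    where
    open ≤-Reasoning
    r+r≡r*2 : numRepeated c + numRepeated c ≡ numRepeated c * 2
    r+r≡r*2 = trans (cong (numRepeated c +_) (sym (+-identityʳ (numRepeated c)))) (*-comm 2 (numRepeated c))

  repeated≤room : numRepeated c ≤ n + numMatching c ∸ k
  repeated≤room = subst (numRepeated c ≤_) room (m+n≤o⇒m≤o∸n (numRepeated c) repeated+lonely≤n)
    where
    open ≡-Reasoning
    room : n ∸ numLonely ≡ n + numMatching c ∸ k
    room = begin
      n ∸ numLonely                                   ≡⟨ sym ([m+n]∸[m+o]≡n∸o (numMatching c) n numLonely) ⟩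
      numMatching c + n ∸ (numMatching c + numLonely) ≡⟨ cong (_∸ (numMatching c + numLonely)) (+-comm (numMatching c) n) ⟩
      n + numMatching c ∸ (numMatching c + numLonely) ≡⟨ cong (n + numMatching c ∸_) matching+lonely ⟩
      n + numMatching c ∸ k                           ∎

  repeatBound : numRepeated c ≤ (numMatching c / 2) ⊓ (n + numMatching c ∸ k)
  repeatBound = ⊓-glb repeated≤half repeated≤room

-- For fixed length k, sorting the sequences by their number of repeated colours
-- yields the inner sum: that number always lies in the summation range.
sequencesOfLength : ∀ k n m → Σ (Seq k n) (λ c → numMatching c ≡ m)
                              ↔ Fin (sumFromTo 0 ((m / 2) ⊓ ((n + m) ∸ k)) (λ l → Z k n m l))
sequencesOfLength k n m =
  Σ (Seq k n) (λ c → numMatching c ≡ m)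
    ↔⟨ Σ-congˡ (λ {c} → uniqueRepeatCount c) ⟨
  Σ (Seq k n) (λ c → Σ (Fin (suc B)) (λ l → True (profile? (toℕ l) c)))
    ↔⟨ ∃∃↔∃∃ _ ⟩
  Σ (Fin (suc B)) (λ l → Σ (Seq k n) (True ∘ profile? (toℕ l)))
    ↔⟨ Σ-congˡ (λ {l} → count (allSeqs-enumerates k n) (profile? (toℕ l))) ⟨
  Σ (Fin (suc B)) (λ l → Fin (Z k n m (toℕ l)))
    ↔⟨ Fin-sumFromTo 0 B (Z k n m) ⟨
  Fin (sumFromTo 0 B (λ l → Z k n m l)) ∎
  where
  open Related.EquationalReasoning
  B : ℕ
  B = (m / 2) ⊓ ((n + m) ∸ k)
  profile? : (l : ℕ) → Decidable (λ (c : Seq k n) → numMatching c ≡ m × numRepeated c ≡ l)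
  profile? l c = (numMatching c ≟ℕ m) ×-dec (numRepeated c ≟ℕ l)
  uniqueRepeatCount : ∀ c → Σ (Fin (suc B)) (λ l → True (profile? (toℕ l) c)) ↔ (numMatching c ≡ m)
  uniqueRepeatCount c = irrelevant-↔ unique ≡-irrelevant (λ (_ , t) → proj₁ (toWitness t)) exists
    where
    unique : Irrelevant (Σ (Fin (suc B)) (λ l → True (profile? (toℕ l) c)))
    unique (l , t) (l' , t') =
      subtype-≡ (toℕ-injective (trans (sym (proj₂ (toWitness t))) (proj₂ (toWitness t'))))
    exists : numMatching c ≡ m → Σ (Fin (suc B)) (λ l → True (profile? (toℕ l) c))
    exists e = fromℕ< (s≤s bound) , fromWitness (e , sym (toℕ-fromℕ< (s≤s bound)))
      where
      bound : numRepeated c ≤ B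
      bound = subst (λ M → numRepeated c ≤ (M / 2) ⊓ (n + M ∸ k)) e (SequenceFacts.repeatBound c)

mainTheorem3 : (n m : ℕ) → 2 ≤ m →
    Σ ℕ (λ k → Σ (Seq k n) (λ c → numMatching c ≡ m))
      ↔ Fin (sumFromTo m (m + n ∸ 1) (λ k →
               sumFromTo 0 ((m / 2) ⊓ ((n + m) ∸ k)) (λ l → Z k n m l)))
mainTheorem3 n m@(suc m-1) (s≤s _) =
  Σ ℕ Sequences
    ↔⟨ Σ-window Sequences m L window ⟩
  Σ (Fin L) (λ i → Sequences (m + toℕ i))
    ↔⟨ Σ-congˡ (λ {i} → sequencesOfLength (m + toℕ i) n m) ⟩
  Σ (Fin L) (λ i → Fin (innerSum (m + toℕ i)))
    ↔⟨ Fin-sumFromTo m (m + n ∸ 1) innerSum ⟨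
  Fin (sumFromTo m (m + n ∸ 1) innerSum) ∎
  where
  open Related.EquationalReasoning
  innerSum : ℕ → ℕ
  innerSum k = sumFromTo 0 ((m / 2) ⊓ ((n + m) ∸ k)) (λ l → Z k n m l)
  Sequences : ℕ → Set
  Sequences k = Σ (Seq k n) (λ c → numMatching c ≡ m)
  L : ℕ
  L = suc (m + n ∸ 1) ∸ m
  window : ∀ k → Sequences k → m ≤ k × k ∸ m < L
  window k (c , e) rewrite m+n∸m≡n m-1 n =
    subst (_≤ k) e matching≤length ,
    subst (λ M → k ∸ M < n) e (length∸matching<n (subst (1 ≤_) (sym e) (s≤s z≤n)))
    where open SequenceFacts c
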